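{- Let $\xi\in\mathbb{N}$, let $\mathcal{T}=(I,(w_t,B_t,W_t)_{t=1}^d,\mathcal{I},f)$ be a $d$-MKCP instance, and let $S^*,(A^*_t)_{t=1}^d$ be a solution for $\mathcal{T}$. Then there is $S\subseteq S^*$ with $|S|\le\xi$ such that $S^*\setminus S,\ (A^*_t\setminus S)_{t=1}^d$ is a solution for the residual instance of $\mathcal{T}$, $S$, $(A^*_t\cap S)_{t=1}^d$ and $\xi$.
   Context: An MKC over a finite set $I$ is $(w,B,W)$ with $w:I\to\mathbb{R}_{\ge0}$, finite bin set $B$, $W:B\to\mathbb{R}_{\ge0}$. An assignment $A:B\to2^I$ is feasible if $\sum_{i\in A(b)}w(i)\le W(b)$ for all $b$, and is an assignment of $S$ if $S=\bigcup_bA(b)$. For an assignment $A$ and $S\subseteq I$, $A\cap S$ and $A\setminus S$ denote the assignments $b\mapsto A(b)\cap S$ and $b\mapsto A(b)\setminus S$. A $d$-MKCP instance is $(I,(w_t,B_t,W_t)_{t=1}^d,\mathcal{I},f)$ with $d$ MKCs over $I$, a nonnegative submodular $f:2^I\to\mathbb{R}_{\ge0}$, and $\mathcal{I}\subseteq2^I$ which is $2^I$, the independent sets of a matroid, the intersection of independent sets of two matroids, or the matchings of a graph on edge set $I$. A solution is $S\in\mathcal{I}$ together with assignments $(A_t)_{t=1}^d$, $A_t$ a feasible assignment of $S$ w.r.t. $(w_t,B_t,W_t)$. Given an instance $\mathcal{T}$, a solution $S,(A_t)_{t=1}^d$ of it and $\xi\in\mathbb{N}$, the residual instance is $(I',(w_t,B_t,W'_t)_{t=1}^d,\mathcal{I}',g)$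 where $I'=\{i\in I\setminus S: f(S\cup\{i\})-f(S)\le f(S)/\xi\}$, $g:2^{I'}\to\mathbb{R}_{\ge0}$ is $g(T)=f(S\cup T)$, $W'_t(b)=W_t(b)-w_t(A_t(b))$ for $b\in B_t$ (weights restricted to $I'$), and $\mathcal{I}'=\{T\subseteq I':T\cup S\in\mathcal{I}\}$. A solution of the residual instance is $T\in\mathcal{I}'$ with feasible assignments of $T$ w.r.t. each $(w_t,B_t,W'_t)$. -}

module Defs where

open import Level using (0ℓ)
open import Data.Nat using (ℕ; zero; suc)
open import Data.Fin using (Fin; zero; suc)
open import Data.Fin.Subset using (Subset; _∈_; _∉_; _⊆_; _∩_; _∪_; _─_; ⁅_⁆; ∣_∣)
  renaming (⊥ to ∅)
open import Data.Vec using (_∷_; [])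
open import Data.Bool using (Bool; true; false; if_then_else_)
open import Data.Product using (Σ; ∃; _×_; _,_)
open import Data.Sum using (_⊎_)
import Data.Nat
import Data.Unit
open import Relation.Nullary using (¬_)
open import Relation.Binary.PropositionalEquality using (_≡_; _≢_)
open import Algebra.Structures using (IsCommutativeRing)

-- Scalars: an ordered field (the paper uses ℝ, which is one).

record OrderedField : Set₁ where
  infixl 6 _+_ _-_
  infixl 7 _*_
  infix 4 _≤_
  field
    Carrier : Set
    _+_ _*_ : Carrier → Carrier → Carrier
    -_ : Carrier → Carrier
    0# 1# : Carrier
    _≤_ : Carrier → Carrier → Set
    isCommutativeRing : IsCommutativeRing _≡_ _+_ _*_ -_ 0# 1#
    0≢1 : 0# ≢ 1#
    inverse : ∀ x → x ≢ 0# → ∃ λ y → x * y ≡ 1#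
    ≤-refl : ∀ {x} → x ≤ x
    ≤-trans : ∀ {x y z} → x ≤ y → y ≤ z → x ≤ z
    ≤-antisym : ∀ {x y} → x ≤ y → y ≤ x → x ≡ y
    ≤-total : ∀ x y → x ≤ y ⊎ y ≤ x
    +-monoˡ-≤ : ∀ {x y} z → x ≤ y → x + z ≤ y + z
    *-nonneg : ∀ {x y} → 0# ≤ x → 0# ≤ y → 0# ≤ x * y

  _-_ : Carrier → Carrier → Carrier
  x - y = x + (- y)

  _×ℕ_ : ℕ → Carrier → Carrier
  zero ×ℕ x = 0#
  suc k ×ℕ x = x + (k ×ℕ x)

module _ (F : OrderedField) where
  open OrderedField F

  wsum : ∀ {n} → (Fin n → Carrier) → Subset n → Carrier
  wsum {zero} w [] = 0#
  wsum {suc n} w (b ∷ p) = (if b then w zero else 0#) + wsum (λ i → w (suc i)) p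

  record MKC (n : ℕ) : Set where
    field
      bins : ℕ
      w : Fin n → Carrier
      W : Fin bins → Carrier
      w-nonneg : ∀ i → 0# ≤ w i
      W-nonneg : ∀ b → 0# ≤ W b

  Assignment : ∀ {n} → MKC n → Set
  Assignment {n} K = Fin (MKC.bins K) → Subset n

  FeasibleWrt : ∀ {n m} → (Fin n → Carrier) → (Fin m → Carrier) → (Fin m → Subset n) → Set
  FeasibleWrt w W A = ∀ b → wsum w (A b) ≤ W b

  AssignmentOf : ∀ {n m} → (Fin m → Subset n) → Subset n → Set
  AssignmentOf A S = ∀ i → (i ∈ S → ∃ λ b → i ∈ A b) × (∀ b → i ∈ A b → i ∈ S)

  record Matroid (n : ℕ) : Set₁ where
    field
      Indep : Subset n → Set
      indep-∅ : Indep ∅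
      indep-down : ∀ {X Y} → X ⊆ Y → Indep Y → Indep X
      indep-exchange : ∀ {X Y} → Indep X → Indep Y → Data.Nat._<_ ∣ X ∣ ∣ Y ∣ →
                       ∃ λ i → i ∈ Y × i ∉ X × Indep (X ∪ ⁅ i ⁆)

  record Graph (n : ℕ) : Set where
    field
      v : ℕ
      end₁ end₂ : Fin n → Fin v
      no-loop : ∀ e → end₁ e ≢ end₂ e
      no-parallel : ∀ e e′ → ((end₁ e ≡ end₁ e′ × end₂ e ≡ end₂ e′) ⊎
                               (end₁ e ≡ end₂ e′ × end₂ e ≡ end₁ e′)) → e ≡ e′

  IsEnd : ∀ {n} (G : Graph n) → Fin (Graph.v G) → Fin n → Set
  IsEnd G u e = u ≡ Graph.end₁ G e ⊎ u ≡ Graph.end₂ G e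

  IsMatching : ∀ {n} → Graph n → Subset n → Set
  IsMatching G M = ∀ e e′ → e ∈ M → e′ ∈ M → e ≢ e′ →
                   ∀ u → IsEnd G u e → ¬ IsEnd G u e′

  data Constraint (n : ℕ) : Set₁ where
    free : Constraint n
    matroid : Matroid n → Constraint n
    matroid∩ : Matroid n → Matroid n → Constraint n
    matching : Graph n → Constraint n

  Indep : ∀ {n} → Constraint n → Subset n → Set
  Indep free X = Data.Unit.⊤
  Indep (matroid M) X = Matroid.Indep M X
  Indep (matroid∩ M₁ M₂) X = Matroid.Indep M₁ X × Matroid.Indep M₂ X
  Indep (matching G) X = IsMatching G X

  Submodular : ∀ {n} → (Subset n → Carrier) → Set
  Submodular f = ∀ X Y → f (X ∪ Y) + f (X ∩ Y) ≤ f X + f Y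

  record Instance (n : ℕ) : Set₁ where
    field
      d : ℕ
      mkc : Fin d → MKC n
      𝓘 : Constraint n
      f : Subset n → Carrier
      f-nonneg : ∀ X → 0# ≤ f X
      f-submodular : Submodular f

  module _ {n} (𝒯 : Instance n) where
    open Instance 𝒯

    Assignments : Set
    Assignments = (t : Fin d) → Assignment (mkc t)

    IsSolution : Subset n → Assignments → Set
    IsSolution S A = Indep 𝓘 S ×
      (∀ t → AssignmentOf (A t) S × FeasibleWrt (MKC.w (mkc t)) (MKC.W (mkc t)) (A t))

    -- Residual instance of 𝒯, S, (A_t) and ξ:
    --   I'  = { i ∈ I ∖ S : ξ·(f(S ∪ {i}) − f(S)) ≤ f(S) }   (i.e. marginal ≤ f(S)/ξ)
    --   W'_t(b) = W_t(b) − w_t(A_t(b))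
    --   𝓘' = { T ⊆ I' : T ∪ S ∈ 𝓘 }
    InResidualGround : ℕ → Subset n → Fin n → Set
    InResidualGround ξ S i = i ∉ S × (ξ ×ℕ (f (S ∪ ⁅ i ⁆) - f S)) ≤ f S

    ResidualCapacity : Assignments → (t : Fin d) → Fin (MKC.bins (mkc t)) → Carrier
    ResidualCapacity A t b = MKC.W (mkc t) b - wsum (MKC.w (mkc t)) (A t b)

    IsResidualSolution : ℕ → Subset n → Assignments → Subset n → Assignments → Set
    IsResidualSolution ξ S A T A′ =
      (∀ i → i ∈ T → InResidualGround ξ S i) ×
      Indep 𝓘 (T ∪ S) ×
      (∀ t → AssignmentOf (A′ t) T ×
             FeasibleWrt (MKC.w (mkc t)) (ResidualCapacity A t) (A′ t))

-- Run the greedy algorithm on S* for ξ rounds, each time adding the remaining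
-- element of largest marginal gain. By submodularity marginal gains only shrink
-- as S grows, so after k rounds every remaining element i of S* has gained at
-- most as much as each of the k chosen elements did when chosen; these k gains
-- telescope to at most f(S), giving k · (f(S ∪ {i}) − f(S)) ≤ f(S). With
-- k = ξ this is exactly membership of i in the residual ground set. The
-- knapsack part is bookkeeping: A*(b) splits into A*(b) ∩ S, which fits into
-- W(b), and A*(b) ∖ S, which fits into what A*(b) ∩ S leaves of W(b).
module Submission where

open import Defs
open import Data.Nat using (ℕ; _≤_)
open import Data.Fin.Subset using (Subset; _⊆_; _∩_; _─_; ∣_∣)
open import Data.Product using (Σ; _×_)

open import Level using (0ℓ)
open import Function using (_∘_)
open import Data.Bool using (true; false)
open import Data.Empty using (⊥-elim)
open import Data.Fin using (Fin; zero; suc)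
open import Data.Fin.Subset using (_∈_; _∉_; _∪_; ⁅_⁆; Empty) renaming (⊥ to ∅)
open import Data.Fin.Subset.Properties
open import Data.Nat using (z≤n; s≤s)
import Data.Nat as ℕ
import Data.Nat.Properties as ℕₚ
open import Data.Product using (_,_; ∃; proj₁; proj₂)
open import Data.Sum using (_⊎_; inj₁; inj₂)
open import Data.Vec.Base using (_∷_; []; here; there)
open import Relation.Binary.Bundles using (Poset; TotalPreorder)
open import Relation.Binary.PropositionalEquality
  using (_≡_; refl; sym; cong; subst; subst₂; isEquivalence)
open import Relation.Nullary using (yes; no)
open import Algebra.Bundles using (CommutativeRing)
import Algebra.Properties.Group as GroupProperties
import Algebra.Properties.CommutativeSemigroup as CommutativeSemigroupProperties
import Relation.Binary.Reasoning.PartialOrder as PartialOrderReasoning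

module OrderedFieldProperties (F : OrderedField) where
  open OrderedField F renaming (_≤_ to _⊑_)

  commutativeRing : CommutativeRing 0ℓ 0ℓ
  commutativeRing = record { isCommutativeRing = isCommutativeRing }

  open CommutativeRing commutativeRing
    using (+-comm; +-identityˡ; +-identityʳ; +-group; +-commutativeSemigroup)
  open GroupProperties +-group using (//-rightDividesˡ; //-rightDividesʳ)
  open CommutativeSemigroupProperties +-commutativeSemigroup using (interchange; xy∙z≈xz∙y)

  poset : Poset 0ℓ 0ℓ 0ℓ
  poset = record
    { isPartialOrder = record
      { isPreorder = record
        { isEquivalence = isEquivalence
        ; reflexive = λ { refl → ≤-refl }
        ; trans = ≤-trans
        }
      ; antisym = ≤-antisym
      }
    }

  totalPreorder : TotalPreorder 0ℓ 0ℓ 0ℓ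
  totalPreorder = record
    { isTotalPreorder = record { isPreorder = Poset.isPreorder poset ; total = ≤-total } }

  module ⊑-Reasoning = PartialOrderReasoning poset
  open ⊑-Reasoning

  +-mono-⊑ : ∀ {x y u v} → x ⊑ y → u ⊑ v → x + u ⊑ y + v
  +-mono-⊑ {x} {y} {u} {v} x⊑y u⊑v = begin
    x + u  ≤⟨ +-monoˡ-≤ u x⊑y ⟩
    y + u  ≡⟨ +-comm y u ⟩
    u + y  ≤⟨ +-monoˡ-≤ y u⊑v ⟩
    v + y  ≡⟨ +-comm v y ⟩
    y + v  ∎

  ×ℕ-mono-⊑ : ∀ k {x y} → x ⊑ y → k ×ℕ x ⊑ k ×ℕ y
  ×ℕ-mono-⊑ ℕ.zero    x⊑y = ≤-refl
  ×ℕ-mono-⊑ (ℕ.suc k) x⊑y = +-mono-⊑ x⊑y (×ℕ-mono-⊑ k x⊑y)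

  0⊑x⇒y⊑x+y : ∀ {x} y → 0# ⊑ x → y ⊑ x + y
  0⊑x⇒y⊑x+y {x} y 0⊑x = begin
    y       ≡⟨ +-identityˡ y ⟨
    0# + y  ≤⟨ +-monoˡ-≤ y 0⊑x ⟩
    x + y   ∎

  x-y+y≡x : ∀ x y → (x - y) + y ≡ x
  x-y+y≡x x y = //-rightDividesˡ y x

  x+y⊑z⇒x⊑z-y : ∀ {x y z} → x + y ⊑ z → x ⊑ z - y
  x+y⊑z⇒x⊑z-y {x} {y} {z} x+y⊑z = begin
    x            ≡⟨ //-rightDividesʳ y x ⟨
    (x + y) - y  ≤⟨ +-monoˡ-≤ (- y) x+y⊑z ⟩
    z - y        ∎

  x+w⊑z+y⇒x-y⊑z-w : ∀ {x y z w} → x + w ⊑ z + y → x - y ⊑ z - w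
  x+w⊑z+y⇒x-y⊑z-w {x} {y} {z} {w} x+w⊑z+y = x+y⊑z⇒x⊑z-y (begin
    (x - y) + w  ≡⟨ xy∙z≈xz∙y x (- y) w ⟩
    (x + w) - y  ≤⟨ +-monoˡ-≤ (- y) x+w⊑z+y ⟩
    (z + y) - y  ≡⟨ //-rightDividesʳ y z ⟩
    z            ∎)

  +-split-≡ : ∀ {x y z a u v} → x ≡ y + z → a ≡ u + v → x + a ≡ (y + u) + (z + v)
  +-split-≡ refl refl = interchange _ _ _ _

  0#≡0#+0# : 0# ≡ 0# + 0#
  0#≡0#+0# = sym (+-identityˡ 0#)

  +-nonneg : ∀ {x y} → 0# ⊑ x → 0# ⊑ y → 0# ⊑ x + y
  +-nonneg {x} {y} 0⊑x 0⊑y = begin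
    0#       ≡⟨ 0#≡0#+0# ⟩
    0# + 0#  ≤⟨ +-mono-⊑ 0⊑x 0⊑y ⟩
    x + y    ∎

module Argmax (P : TotalPreorder 0ℓ 0ℓ 0ℓ) where
  open TotalPreorder P using (Carrier; _≲_; total) renaming (refl to ≲-refl; trans to ≲-trans)

  argmax : ∀ {n} (g : Fin n → Carrier) (T : Subset n) →
           Empty T ⊎ ∃ λ j → j ∈ T × (∀ i → i ∈ T → g i ≲ g j)
  argmax {ℕ.zero} g [] = inj₁ λ ()
  argmax {ℕ.suc n} g (b ∷ T) with b | argmax (g ∘ suc) T
  ... | false | inj₁ empty = inj₁ λ { (suc i , there i∈T) → empty (i , i∈T) }
  ... | false | inj₂ (j , j∈T , max) =
    inj₂ (suc j , there j∈T , λ { (suc i) (there i∈T) → max i i∈T })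
  ... | true | inj₁ empty =
    inj₂ (zero , here , λ { zero here → ≲-refl ; (suc i) (there i∈T) → ⊥-elim (empty (i , i∈T)) })
  ... | true | inj₂ (j , j∈T , max) with total (g zero) (g (suc j))
  ...   | inj₁ g0≲gj = inj₂ (suc j , there j∈T ,
            λ { zero here → g0≲gj ; (suc i) (there i∈T) → max i i∈T })
  ...   | inj₂ gj≲g0 = inj₂ (zero , here ,
            λ { zero here → ≲-refl ; (suc i) (there i∈T) → ≲-trans (max i i∈T) gj≲g0 })

x∈p─q⇒x∉q : ∀ {n} {x : Fin n} {p q : Subset n} → x ∈ p ─ q → x ∉ q
x∈p─q⇒x∉q {p = true ∷ p} {false ∷ q} here         ()
x∈p─q⇒x∉q {p = _    ∷ p} {_     ∷ q} (there x∈p─q) (there x∈q) = x∈p─q⇒x∉q x∈p─q x∈q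

module _ {n : ℕ} where

  ∪-lub : ∀ {p q r : Subset n} → p ⊆ r → q ⊆ r → p ∪ q ⊆ r
  ∪-lub {p} {q} p⊆r q⊆r x∈p∪q with x∈p∪q⁻ p q x∈p∪q
  ... | inj₁ x∈p = p⊆r x∈p
  ... | inj₂ x∈q = q⊆r x∈q

  x∈p⇒⁅x⁆⊆p : ∀ {x : Fin n} {p : Subset n} → x ∈ p → ⁅ x ⁆ ⊆ p
  x∈p⇒⁅x⁆⊆p {x} x∈p y∈⁅x⁆ with x∈⁅y⁆⇒x≡y x y∈⁅x⁆
  ... | refl = x∈p

  p⊆r⇒p∪q∪r≡r∪q : ∀ {p r : Subset n} (q : Subset n) → p ⊆ r → (p ∪ q) ∪ r ≡ r ∪ q
  p⊆r⇒p∪q∪r≡r∪q {p} {r} q p⊆r = ⊆-antisym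
    (∪-lub (∪-lub (p⊆p∪q q ∘ p⊆r) (q⊆p∪q r q)) (p⊆p∪q q))
    (∪-lub (q⊆p∪q (p ∪ q) r) (p⊆p∪q r ∘ q⊆p∪q p q))

  p⊆q⇒x∉q⇒p∪⁅x⁆∩q≡p : ∀ {p q : Subset n} {x : Fin n} → p ⊆ q → x ∉ q → (p ∪ ⁅ x ⁆) ∩ q ≡ p
  p⊆q⇒x∉q⇒p∪⁅x⁆∩q≡p {p} {q} {x} p⊆q x∉q = ⊆-antisym ⊆p (λ y∈p → x∈p∩q⁺ (p⊆p∪q ⁅ x ⁆ y∈p , p⊆q y∈p))
    where
    ⊆p : (p ∪ ⁅ x ⁆) ∩ q ⊆ p
    ⊆p y∈ with x∈p∩q⁻ (p ∪ ⁅ x ⁆) q y∈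
    ... | y∈p∪x , y∈q with x∈p∪q⁻ p ⁅ x ⁆ y∈p∪x
    ...   | inj₁ y∈p = y∈p
    ...   | inj₂ y∈⁅x⁆ with refl ← x∈⁅y⁆⇒x≡y x y∈⁅x⁆ = ⊥-elim (x∉q y∈q)

  q⊆p⇒p─q∪q≡p : ∀ {p q : Subset n} → q ⊆ p → (p ─ q) ∪ q ≡ p
  q⊆p⇒p─q∪q≡p {p} {q} q⊆p = ⊆-antisym (∪-lub (p─q⊆p p q) q⊆p) ⊆p─q∪q
    where
    ⊆p─q∪q : p ⊆ (p ─ q) ∪ q
    ⊆p─q∪q {y} y∈p with y ∈? q
    ... | yes y∈q = q⊆p∪q (p ─ q) q y∈q
    ... | no  y∉q = p⊆p∪q q (x∈p∧x∉q⇒x∈p─q y∈p y∉q)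

∣p∪q∣≤∣p∣+∣q∣ : ∀ {n} (p q : Subset n) → ∣ p ∪ q ∣ ≤ ∣ p ∣ ℕ.+ ∣ q ∣
∣p∪q∣≤∣p∣+∣q∣ []          []          = z≤n
∣p∪q∣≤∣p∣+∣q∣ (true  ∷ p) (true  ∷ q) =
  s≤s (ℕₚ.≤-trans (∣p∪q∣≤∣p∣+∣q∣ p q) (ℕₚ.+-monoʳ-≤ ∣ p ∣ (ℕₚ.n≤1+n ∣ q ∣)))
∣p∪q∣≤∣p∣+∣q∣ (true  ∷ p) (false ∷ q) = s≤s (∣p∪q∣≤∣p∣+∣q∣ p q)
∣p∪q∣≤∣p∣+∣q∣ (false ∷ p) (true  ∷ q) =
  ℕₚ.≤-trans (s≤s (∣p∪q∣≤∣p∣+∣q∣ p q)) (ℕₚ.≤-reflexive (sym (ℕₚ.+-suc ∣ p ∣ ∣ q ∣)))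
∣p∪q∣≤∣p∣+∣q∣ (false ∷ p) (false ∷ q) = ∣p∪q∣≤∣p∣+∣q∣ p q

∣p∪⁅x⁆∣≤1+∣p∣ : ∀ {n} (p : Subset n) (x : Fin n) → ∣ p ∪ ⁅ x ⁆ ∣ ≤ ℕ.suc ∣ p ∣
∣p∪⁅x⁆∣≤1+∣p∣ p x = begin
  ∣ p ∪ ⁅ x ⁆ ∣        ≤⟨ ∣p∪q∣≤∣p∣+∣q∣ p ⁅ x ⁆ ⟩
  ∣ p ∣ ℕ.+ ∣ ⁅ x ⁆ ∣  ≡⟨ cong (∣ p ∣ ℕ.+_) (∣⁅x⁆∣≡1 x) ⟩
  ∣ p ∣ ℕ.+ 1          ≡⟨ ℕₚ.+-comm ∣ p ∣ 1 ⟩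
  ℕ.suc ∣ p ∣          ∎
  where open ℕₚ.≤-Reasoning

module WeightedSums (F : OrderedField) where
  open OrderedField F renaming (_≤_ to _⊑_)
  open OrderedFieldProperties F
  open CommutativeRing commutativeRing using (+-identityˡ; +-identityʳ)

  wsum-nonneg : ∀ {n} (w : Fin n → Carrier) → (∀ i → 0# ⊑ w i) → ∀ A → 0# ⊑ wsum F w A
  wsum-nonneg w w≥0 []          = ≤-refl
  wsum-nonneg w w≥0 (true  ∷ A) = +-nonneg (w≥0 zero) (wsum-nonneg (w ∘ suc) (w≥0 ∘ suc) A)
  wsum-nonneg w w≥0 (false ∷ A) = +-nonneg ≤-refl (wsum-nonneg (w ∘ suc) (w≥0 ∘ suc) A)

  wsum-─-∩ : ∀ {n} (w : Fin n → Carrier) (A S : Subset n) →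
             wsum F w A ≡ wsum F w (A ─ S) + wsum F w (A ∩ S)
  wsum-─-∩ w []          []          = 0#≡0#+0#
  wsum-─-∩ w (true  ∷ A) (true  ∷ S) = +-split-≡ (sym (+-identityˡ (w zero))) (wsum-─-∩ (w ∘ suc) A S)
  wsum-─-∩ w (true  ∷ A) (false ∷ S) = +-split-≡ (sym (+-identityʳ (w zero))) (wsum-─-∩ (w ∘ suc) A S)
  wsum-─-∩ w (false ∷ A) (true  ∷ S) = +-split-≡ 0#≡0#+0# (wsum-─-∩ (w ∘ suc) A S)
  wsum-─-∩ w (false ∷ A) (false ∷ S) = +-split-≡ 0#≡0#+0# (wsum-─-∩ (w ∘ suc) A S)

module SubmodularFunctions (F : OrderedField) {n : ℕ} (f : Subset n → OrderedField.Carrier F)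
                           (f-submodular : Submodular F f) where
  open OrderedField F renaming (_≤_ to _⊑_)
  open OrderedFieldProperties F
  open Argmax totalPreorder

  marginal : Fin n → Subset n → Carrier
  marginal i S = f (S ∪ ⁅ i ⁆) - f S

  MarginalsBoundedBy : ℕ → Subset n → Subset n → Set
  MarginalsBoundedBy k S* S = ∀ i → i ∈ S* ─ S → k ×ℕ marginal i S ⊑ f S

  diminishing-returns : ∀ {X Y} i → X ⊆ Y → i ∉ Y → marginal i Y ⊑ marginal i X
  diminishing-returns {X} {Y} i X⊆Y i∉Y = x+w⊑z+y⇒x-y⊑z-w
    (subst₂ (λ U V → f U + f V ⊑ f (X ∪ ⁅ i ⁆) + f Y)
            (p⊆r⇒p∪q∪r≡r∪q ⁅ i ⁆ X⊆Y) (p⊆q⇒x∉q⇒p∪⁅x⁆∩q≡p X⊆Y i∉Y)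
            (f-submodular (X ∪ ⁅ i ⁆) Y))

  module _ (S* S : Subset n) (k : ℕ) (bounded : MarginalsBoundedBy k S* S)
           {j} (j∈ : j ∈ S* ─ S) (j-max : ∀ i → i ∈ S* ─ S → marginal i S ⊑ marginal j S) where
    open ⊑-Reasoning

    greedy-step-bounded : MarginalsBoundedBy (ℕ.suc k) S* (S ∪ ⁅ j ⁆)
    greedy-step-bounded i i∈ = begin
      marginal i (S ∪ ⁅ j ⁆) + k ×ℕ marginal i (S ∪ ⁅ j ⁆)
        ≤⟨ +-mono-⊑ (≤-trans shrinks (j-max i i∈S*─S))
                    (≤-trans (×ℕ-mono-⊑ k shrinks) (bounded i i∈S*─S)) ⟩
      marginal j S + f S
        ≡⟨ x-y+y≡x (f (S ∪ ⁅ j ⁆)) (f S) ⟩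
      f (S ∪ ⁅ j ⁆) ∎
      where
      i∉S∪j : i ∉ S ∪ ⁅ j ⁆
      i∉S∪j = x∈p─q⇒x∉q i∈
      i∈S*─S : i ∈ S* ─ S
      i∈S*─S = x∈p∧x∉q⇒x∈p─q (p─q⊆p S* _ i∈) (i∉S∪j ∘ p⊆p∪q ⁅ j ⁆)
      shrinks : marginal i (S ∪ ⁅ j ⁆) ⊑ marginal i S
      shrinks = diminishing-returns i (p⊆p∪q ⁅ j ⁆) i∉S∪j

  greedy : 0# ⊑ f ∅ → (S* : Subset n) (k : ℕ) →
           Σ (Subset n) λ S → S ⊆ S* × ∣ S ∣ ≤ k × MarginalsBoundedBy k S* S
  greedy f∅≥0 S* ℕ.zero = ∅ , ⊥⊆ , ℕₚ.≤-reflexive (∣⊥∣≡0 n) , λ _ _ → f∅≥0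
  greedy f∅≥0 S* (ℕ.suc k) with greedy f∅≥0 S* k
  ... | S , S⊆S* , ∣S∣≤k , bounded with argmax (λ j → marginal j S) (S* ─ S)
  ...   | inj₁ empty = S , S⊆S* , ℕₚ.m≤n⇒m≤1+n ∣S∣≤k , λ i i∈ → ⊥-elim (empty (i , i∈))
  ...   | inj₂ (j , j∈ , j-max) =
    S ∪ ⁅ j ⁆ ,
    ∪-lub S⊆S* (x∈p⇒⁅x⁆⊆p (p─q⊆p S* S j∈)) ,
    ℕₚ.≤-trans (∣p∪⁅x⁆∣≤1+∣p∣ S j) (s≤s ∣S∣≤k) ,
    greedy-step-bounded S* S k bounded j∈ j-max

module _ (F : OrderedField) {n : ℕ} where
  open OrderedField F renaming (_≤_ to _⊑_)
  open OrderedFieldProperties F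
  open WeightedSums F
  open ⊑-Reasoning

  Indep-down : ∀ (𝓘 : Constraint F n) {X Y} → X ⊆ Y → Indep F 𝓘 Y → Indep F 𝓘 X
  Indep-down free              X⊆Y _                = _
  Indep-down (matroid M)       X⊆Y Y-indep          = Matroid.indep-down M X⊆Y Y-indep
  Indep-down (matroid∩ M₁ M₂)  X⊆Y (Y-indep₁ , Y-indep₂) =
    Matroid.indep-down M₁ X⊆Y Y-indep₁ , Matroid.indep-down M₂ X⊆Y Y-indep₂
  Indep-down (matching G)      X⊆Y Y-matching       = λ e e′ e∈X e′∈X → Y-matching e e′ (X⊆Y e∈X) (X⊆Y e′∈X)

  module _ {m} {A : Fin m → Subset n} {S* : Subset n} (A-of-S* : AssignmentOf F A S*) where

    AssignmentOf-∩ : ∀ {S} → S ⊆ S* → AssignmentOf F (λ b → A b ∩ S) S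
    AssignmentOf-∩ {S} S⊆S* i =
      (λ i∈S → let b , i∈Ab = proj₁ (A-of-S* i) (S⊆S* i∈S) in b , x∈p∩q⁺ (i∈Ab , i∈S)) ,
      (λ b i∈Ab∩S → proj₂ (x∈p∩q⁻ (A b) S i∈Ab∩S))

    AssignmentOf-─ : ∀ S → AssignmentOf F (λ b → A b ─ S) (S* ─ S)
    AssignmentOf-─ S i =
      (λ i∈S*─S → let b , i∈Ab = proj₁ (A-of-S* i) (p─q⊆p S* S i∈S*─S)
                   in b , x∈p∧x∉q⇒x∈p─q i∈Ab (x∈p─q⇒x∉q i∈S*─S)) ,
      (λ b i∈Ab─S → x∈p∧x∉q⇒x∈p─q (proj₂ (A-of-S* i) b (p─q⊆p (A b) S i∈Ab─S)) (x∈p─q⇒x∉q i∈Ab─S))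

  module _ {m} {w : Fin n → Carrier} {W : Fin m → Carrier} {A : Fin m → Subset n}
           (A-fits : FeasibleWrt F w W A) (S : Subset n) where

    FeasibleWrt-∩ : (∀ i → 0# ⊑ w i) → FeasibleWrt F w W (λ b → A b ∩ S)
    FeasibleWrt-∩ w≥0 b = begin
      wsum F w (A b ∩ S)                         ≤⟨ 0⊑x⇒y⊑x+y _ (wsum-nonneg w w≥0 (A b ─ S)) ⟩
      wsum F w (A b ─ S) + wsum F w (A b ∩ S)    ≡⟨ wsum-─-∩ w (A b) S ⟨
      wsum F w (A b)                             ≤⟨ A-fits b ⟩
      W b                                        ∎

    FeasibleWrt-─ : FeasibleWrt F w (λ b → W b - wsum F w (A b ∩ S)) (λ b → A b ─ S)
    FeasibleWrt-─ b = x+y⊑z⇒x⊑z-y (begin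
      wsum F w (A b ─ S) + wsum F w (A b ∩ S)    ≡⟨ wsum-─-∩ w (A b) S ⟨
      wsum F w (A b)                             ≤⟨ A-fits b ⟩
      W b                                        ∎)

module Residual (F : OrderedField) {n : ℕ} (𝒯 : Instance F n) where
  open OrderedField F renaming (_≤_ to _⊑_)
  open Instance 𝒯
  open SubmodularFunctions F f f-submodular public

  split-solution : ∀ ξ {S* S A*} → IsSolution F 𝒯 S* A* → S ⊆ S* → MarginalsBoundedBy ξ S* S →
                   IsSolution F 𝒯 S (λ t b → A* t b ∩ S) ×
                   IsResidualSolution F 𝒯 ξ S (λ t b → A* t b ∩ S) (S* ─ S) (λ t b → A* t b ─ S)
  split-solution ξ {S*} {S} {A*} (S*-indep , A*-packs) S⊆S* bounded =
    (Indep-down F 𝓘 S⊆S* S*-indep ,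
     λ t → AssignmentOf-∩ F (A*-of t) S⊆S* , FeasibleWrt-∩ F (A*-fits t) S (MKC.w-nonneg (mkc t))) ,
    (λ i i∈S*─S → x∈p─q⇒x∉q i∈S*─S , bounded i i∈S*─S) ,
    subst (Indep F 𝓘) (sym (q⊆p⇒p─q∪q≡p S⊆S*)) S*-indep ,
    λ t → AssignmentOf-─ F (A*-of t) S , FeasibleWrt-─ F (A*-fits t) S
    where
    A*-of : ∀ t → AssignmentOf F (A* t) S*
    A*-of t = proj₁ (A*-packs t)
    A*-fits : ∀ t → FeasibleWrt F (MKC.w (mkc t)) (MKC.W (mkc t)) (A* t)
    A*-fits t = proj₂ (A*-packs t)

lemmaB1 : (F : OrderedField) (ξ : ℕ) {n : ℕ} (𝒯 : Instance F n)
          (S* : Subset n) (A* : Assignments F 𝒯) →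
          IsSolution F 𝒯 S* A* →
          Σ (Subset n) λ S →
            S ⊆ S* × ∣ S ∣ ≤ ξ ×
            IsSolution F 𝒯 S (λ t b → A* t b ∩ S) ×
            IsResidualSolution F 𝒯 ξ S (λ t b → A* t b ∩ S) (S* ─ S) (λ t b → A* t b ─ S)
lemmaB1 F ξ 𝒯 S* A* S*-solution =
  let S , S⊆S* , ∣S∣≤ξ , bounded = greedy (Instance.f-nonneg 𝒯 ∅) S* ξ
  in  S , S⊆S* , ∣S∣≤ξ , split-solution ξ S*-solution S⊆S* bounded
  where open Residual F 𝒯
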